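{- Let $H$ be a vertex-monochromatic CCD which is easygoing with respect to a block system $\mathcal B$ of $\mathrm{Aut}(H)$, and let $\mathcal B'\subseteq\mathcal B$. If $\psi,\varphi\in\mathrm{Aut}(H)$ satisfy $\psi^{\mathcal B}|_{\mathcal B'}=\varphi^{\mathcal B}|_{\mathcal B'}$, then there is $\tau\in\mathrm{Aut}(H)$ such that $\tau^{\mathcal B}=\psi^{\mathcal B}$ and $\tau(x)=\varphi(x)$ for all $x\in\bigcup\mathcal B'$.
   Context: A complete colored digraph (CCD) $H$ consists of a finite non-empty vertex set, a vertex coloring and an edge coloring on all ordered pairs of distinct vertices; automorphisms are permutations preserving both colorings; vertex-monochromatic means all vertices have the same color. A block system of $\mathrm{Aut}(H)$ is a partition $\mathcal B$ of $V(H)$ mapped to itself by every automorphism; for $\gamma\in\mathrm{Aut}(H)$, $\gamma^{\mathcal B}$ is the induced permutation of $\mathcal B$, and $\mathrm{Aut}(H)^{\mathcal B}=\{\gamma^{\mathcal B}\}$. $\bigcup\mathcal B'=\bigcup_{X\in\mathcal B'}X$. $H$ is easygoing with respect to $\mathcal B$ if for every $\mathcal B'\subseteq\mathcal B$, the group induced on $\mathcal B$ by the pointwise stabilizer in $\mathrm{Aut}(H)$ of $\bigcup\mathcal B'$ equals the subgroup of $\mathrm{Aut}(H)^{\mathcal B}$ fixing every block of $\mathcal B'$. -}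

module Defs where

open import Data.Nat using (ℕ; suc)
open import Data.Fin using (Fin)
open import Data.Fin.Permutation using (Permutation′; _⟨$⟩ʳ_)
open import Data.Product using (Σ; _×_; ∃)
open import Relation.Binary.PropositionalEquality using (_≡_; _≢_)
open import Relation.Unary using (Pred)
open import Level using (0ℓ)

-- A complete colored digraph with vertex set Fin n: a vertex colouring into
-- VColor and an edge colouring into EColor of all ordered pairs of distinct
-- vertices.  (Non-emptiness is imposed in the theorem by taking n = suc k.)
record CCD (n : ℕ) : Set₁ where
  field
    VColor : Set
    EColor : Set
    vcol   : Fin n → VColor
    ecol   : (x y : Fin n) → x ≢ y → EColor
open CCD public

VertexMonochromatic : {n : ℕ} → CCD n → Set
VertexMonochromatic {n} H = (x y : Fin n) → vcol H x ≡ vcol H y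

IsAut : {n : ℕ} → CCD n → Permutation′ n → Set
IsAut {n} H γ =
  ((x : Fin n) → vcol H (γ ⟨$⟩ʳ x) ≡ vcol H x) ×
  ((x y : Fin n) (p : x ≢ y) (q : γ ⟨$⟩ʳ x ≢ γ ⟨$⟩ʳ y) →
     ecol H (γ ⟨$⟩ʳ x) (γ ⟨$⟩ʳ y) q ≡ ecol H x y p)

-- A partition of Fin n into m blocks is given by a surjection blk : Fin n → Fin m;
-- the blocks are the (non-empty) fibres blk⁻¹(b), b : Fin m.
Surjective : {n m : ℕ} → (Fin n → Fin m) → Set
Surjective {n} {m} blk = (b : Fin m) → ∃ λ (x : Fin n) → blk x ≡ b

IsBlockSystem : {n m : ℕ} → CCD n → (Fin n → Fin m) → Set
IsBlockSystem {n} H blk =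
  Surjective blk ×
  ((γ : Permutation′ n) → IsAut H γ →
     (x y : Fin n) → blk x ≡ blk y → blk (γ ⟨$⟩ʳ x) ≡ blk (γ ⟨$⟩ʳ y))

-- γ^B = δ^B  (the induced permutations of the blocks agree), unfolded: γ(x)
-- and δ(x) lie in the same block for every vertex x.
SameInduced : {n m : ℕ} → (Fin n → Fin m) → Permutation′ n → Permutation′ n → Set
SameInduced {n} blk γ δ = (x : Fin n) → blk (γ ⟨$⟩ʳ x) ≡ blk (δ ⟨$⟩ʳ x)

SameInducedOn : {n m : ℕ} → (Fin n → Fin m) → Pred (Fin m) 0ℓ →
                Permutation′ n → Permutation′ n → Set
SameInducedOn {n} blk B' γ δ =
  (x : Fin n) → B' (blk x) → blk (γ ⟨$⟩ʳ x) ≡ blk (δ ⟨$⟩ʳ x)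

FixesBlocks : {n m : ℕ} → (Fin n → Fin m) → Pred (Fin m) 0ℓ → Permutation′ n → Set
FixesBlocks {n} blk B' γ = (x : Fin n) → B' (blk x) → blk (γ ⟨$⟩ʳ x) ≡ blk x

FixesUnionPointwise : {n m : ℕ} → (Fin n → Fin m) → Pred (Fin m) 0ℓ → Permutation′ n → Set
FixesUnionPointwise {n} blk B' γ = (x : Fin n) → B' (blk x) → γ ⟨$⟩ʳ x ≡ x

-- H is easygoing w.r.t. B: for every B' ⊆ B,
--   { δ^B : δ ∈ Aut(H), δ fixes ⋃B' pointwise } = { γ^B ∈ Aut(H)^B : γ^B fixes every block of B' }.
-- Both inclusions are stated.
Easygoing : {n m : ℕ} → CCD n → (Fin n → Fin m) → Set₁
Easygoing {n} {m} H blk = (B' : Pred (Fin m) 0ℓ) →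
  ((δ : Permutation′ n) → IsAut H δ → FixesUnionPointwise blk B' δ →
     FixesBlocks blk B' δ) ×
  ((γ : Permutation′ n) → IsAut H γ → FixesBlocks blk B' γ →
     Σ (Permutation′ n) λ δ → IsAut H δ × FixesUnionPointwise blk B' δ × SameInduced blk δ γ)

{-# OPTIONS --safe #-}
module Submission where

-- The automorphism γ = φ⁻¹ψ fixes every block of B′, because ψ and φ induce the
-- same map on B′.  Easygoingness yields an automorphism δ fixing ⋃B′ pointwise
-- with δ^B = γ^B, and τ = φδ then agrees with φ on ⋃B′ while τ^B = φ^B γ^B = ψ^B.
-- Since π ∘ₚ ρ applies π first, φ⁻¹ψ is ψ ∘ₚ flip φ and φδ is δ ∘ₚ φ.

open import Defs
open import Data.Nat using (ℕ; suc)
open import Data.Fin using (Fin)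
open import Data.Fin.Permutation using (Permutation′; _⟨$⟩ʳ_; _⟨$⟩ˡ_; _∘ₚ_; flip; inverseˡ; inverseʳ)
open import Data.Product using (Σ; _×_; _,_; proj₂)
open import Function.Bundles using (Injection)
open import Function.Properties.Inverse using (↔⇒↣)
open import Relation.Binary.PropositionalEquality using (_≡_; _≢_; refl; sym; trans; cong; subst₂)
open import Relation.Unary using (Pred)
open import Level using (0ℓ)

⟨$⟩ʳ-≢ : {n : ℕ} (π : Permutation′ n) {x y : Fin n} → x ≢ y → π ⟨$⟩ʳ x ≢ π ⟨$⟩ʳ y
⟨$⟩ʳ-≢ π x≢y πx≡πy = x≢y (Injection.injective (↔⇒↣ π) πx≡πy)

module _ {n : ℕ} (H : CCD n) where

  -- ecol depends on the proof of x ≢ y, so colours of equal pairs can only be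
  -- compared once that proof is transported along the equalities.
  ecol-subst : {a b x y : Fin n} (a≡x : a ≡ x) (b≡y : b ≡ y) (x≢y : x ≢ y) →
    ecol H a b (subst₂ _≢_ (sym a≡x) (sym b≡y) x≢y) ≡ ecol H x y x≢y
  ecol-subst refl refl x≢y = refl

  flip-IsAut : (π : Permutation′ n) → IsAut H π → IsAut H (flip π)
  flip-IsAut π (vcol-π , ecol-π) = vcol-π⁻¹ , ecol-π⁻¹
    where
    vcol-π⁻¹ : (x : Fin n) → vcol H (π ⟨$⟩ˡ x) ≡ vcol H x
    vcol-π⁻¹ x = trans (sym (vcol-π (π ⟨$⟩ˡ x))) (cong (vcol H) (inverseʳ π))

    ecol-π⁻¹ : (x y : Fin n) (x≢y : x ≢ y) (q : π ⟨$⟩ˡ x ≢ π ⟨$⟩ˡ y) →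
               ecol H (π ⟨$⟩ˡ x) (π ⟨$⟩ˡ y) q ≡ ecol H x y x≢y
    ecol-π⁻¹ x y x≢y q = trans (sym (ecol-π (π ⟨$⟩ˡ x) (π ⟨$⟩ˡ y) q _))
                               (ecol-subst (inverseʳ π) (inverseʳ π) x≢y)

  ∘ₚ-IsAut : (π ρ : Permutation′ n) → IsAut H π → IsAut H ρ → IsAut H (π ∘ₚ ρ)
  ∘ₚ-IsAut π ρ (vcol-π , ecol-π) (vcol-ρ , ecol-ρ) =
    (λ x → trans (vcol-ρ (π ⟨$⟩ʳ x)) (vcol-π x)) ,
    (λ x y x≢y q → trans (ecol-ρ (π ⟨$⟩ʳ x) (π ⟨$⟩ʳ y) (⟨$⟩ʳ-≢ π x≢y) q)
                         (ecol-π x y x≢y (⟨$⟩ʳ-≢ π x≢y)))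

module _ {n m : ℕ} {H : CCD n} {blk : Fin n → Fin m} (blocks : IsBlockSystem H blk) where

  private
    preservesBlocks = proj₂ blocks

  SameInduced-∘ₚ : (γ δ π : Permutation′ n) → IsAut H π →
    SameInduced blk γ δ → SameInduced blk (γ ∘ₚ π) (δ ∘ₚ π)
  SameInduced-∘ₚ γ δ π aut-π γ~δ x = preservesBlocks π aut-π _ _ (γ~δ x)

  FixesBlocks-∘ₚ-flip : (B' : Pred (Fin m) 0ℓ) (ψ φ : Permutation′ n) → IsAut H φ →
    SameInducedOn blk B' ψ φ → FixesBlocks blk B' (ψ ∘ₚ flip φ)
  FixesBlocks-∘ₚ-flip B' ψ φ aut-φ ψ~φ x x∈⋃B' =
    trans (preservesBlocks (flip φ) (flip-IsAut H φ aut-φ) _ _ (ψ~φ x x∈⋃B'))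
          (cong blk (inverseˡ φ))

mainTheorem4 : (k m : ℕ) (H : CCD (suc k)) (blk : Fin (suc k) → Fin m) →
    VertexMonochromatic H → IsBlockSystem H blk → Easygoing H blk →
    (B' : Pred (Fin m) 0ℓ) (ψ φ : Permutation′ (suc k)) →
    IsAut H ψ → IsAut H φ → SameInducedOn blk B' ψ φ →
    Σ (Permutation′ (suc k)) λ τ → IsAut H τ × SameInduced blk τ ψ ×
    ((x : Fin (suc k)) → B' (blk x) → τ ⟨$⟩ʳ x ≡ φ ⟨$⟩ʳ x)
mainTheorem4 k m H blk _ blocks easygoing B' ψ φ aut-ψ aut-φ ψ~φ
  with proj₂ (easygoing B') (ψ ∘ₚ flip φ)
         (∘ₚ-IsAut H ψ (flip φ) aut-ψ (flip-IsAut H φ aut-φ))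
         (FixesBlocks-∘ₚ-flip blocks B' ψ φ aut-φ ψ~φ)
... | δ , aut-δ , δ-fixes-⋃B' , δ~φ⁻¹ψ =
  δ ∘ₚ φ , ∘ₚ-IsAut H δ φ aut-δ aut-φ , τ~ψ , λ x x∈⋃B' → cong (φ ⟨$⟩ʳ_) (δ-fixes-⋃B' x x∈⋃B')
  where
  τ~ψ : SameInduced blk (δ ∘ₚ φ) ψ
  τ~ψ x = trans (SameInduced-∘ₚ blocks δ (ψ ∘ₚ flip φ) φ aut-φ δ~φ⁻¹ψ x) (cong blk (inverseʳ φ))
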